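{- There is an absolute constant $c$ such that the following holds. Let $R$ be any BST on $[n]$ (the reference tree), let $T$ be any BST on $[n]$, and let $i\in[n]$. Let $T'$ be the tree obtained from $T$ by splaying $i$. Then the amortized cost of this splay, namely (number of rotations performed) $+\ \phi_R(T')-\phi_R(T)$, is at most $c\,(1+d_R(i))$.
   Context: $d_R(j)$ is the depth of key $j$ in $R$ (root depth $0$). For a BST $T$ on $[n]$ and key $x$, $T(x)$ denotes the set of keys in the subtree of $T$ rooted at $x$. Min-depth potential: $\phi_R(T)=\sum_{x=1}^n\phi_R(x)$ where $\phi_R(x)=-2\min_{j\in T(x)}d_R(j)$. Splaying $i$ (Sleator–Tarjan): while $i$ is not the root: if its parent $p$ is the root, rotate $i$ with $p$ (zig, 1 rotation); else if $i$ and $p$ are both left children or both right children, rotate $p$ with its parent then rotate $i$ with its parent (zig-zig, 2 rotations); otherwise rotate $i$ with $p$ and then with its new parent (zig-zag, 2 rotations). -}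

module Defs where

open import Data.Nat using (ℕ; zero; suc; _+_; _*_; _⊓_; _<ᵇ_; _≡ᵇ_)
open import Data.Bool using (if_then_else_)
open import Data.List using (List; []; _∷_; _++_; map; upTo)
open import Data.Nat.ListAction using (sum)
open import Data.Product using (_×_; _,_)
open import Data.Maybe using (Maybe; just; nothing)
open import Data.Integer as ℤ using (ℤ)
open import Relation.Binary.PropositionalEquality using (_≡_)

data Tree : Set where
  leaf : Tree
  node : Tree → ℕ → Tree → Tree

inorder : Tree → List ℕ
inorder leaf = []
inorder (node l k r) = inorder l ++ (k ∷ inorder r)

keys[_] : ℕ → List ℕ
keys[ n ] = map suc (upTo n)

IsBSTOn : ℕ → Tree → Set
IsBSTOn n t = inorder t ≡ keys[ n ]

-- Depth of key j in a BST (root depth 0), found by BST search.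
-- (Junk value for absent keys; only used on present keys.)
depth : Tree → ℕ → ℕ
depth leaf j = 0
depth (node l k r) j =
  if j <ᵇ k then suc (depth l j)
  else if j ≡ᵇ k then 0
  else suc (depth r j)

subtreeAt : Tree → ℕ → Tree
subtreeAt leaf x = leaf
subtreeAt (node l k r) x =
  if x <ᵇ k then subtreeAt l x
  else if x ≡ᵇ k then node l k r
  else subtreeAt r x

-- Minimum of a list (junk 0 for the empty list).
minList : List ℕ → ℕ
minList [] = 0
minList (x ∷ []) = x
minList (x ∷ y ∷ ys) = x ⊓ minList (y ∷ ys)

minDepthIn : Tree → Tree → ℕ → ℕ
minDepthIn R T x = minList (map (depth R) (inorder (subtreeAt T x)))

φ : ℕ → Tree → Tree → ℤ
φ n R T = ℤ.- (ℤ.+ (2 * sum (map (minDepthIn R T) keys[ n ])))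

-- A frame records how the current subtree hangs below its parent:
--   goL k r : current subtree c is the left child of  node c k r
--   goR l k : current subtree c is the right child of node l k c
data Frame : Set where
  goL : ℕ → Tree → Frame
  goR : Tree → ℕ → Frame

-- Path from the current node up to the root (parent frame first).
Path : Set
Path = List Frame

locate : ℕ → Tree → Path → Maybe (Tree × Tree × Path)
locate i leaf p = nothing
locate i (node l k r) p =
  if i <ᵇ k then locate i l (goL k r ∷ p)
  else if i ≡ᵇ k then just (l , r , p)
  else locate i r (goR l k ∷ p)

splayUp : ℕ → Tree → Tree → Path → Tree × ℕ
splayUp i a b [] = node a i b , 0
splayUp i a b (goL k r ∷ []) = node a i (node b k r) , 1
splayUp i a b (goR l k ∷ []) = node (node l k a) i b , 1
splayUp i a b (goL p pr ∷ goL g gr ∷ rest) with splayUp i a (node b p (node pr g gr)) rest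
... | t , m = t , 2 + m
splayUp i a b (goR pl p ∷ goR gl g ∷ rest) with splayUp i (node (node gl g pl) p a) b rest
... | t , m = t , 2 + m
splayUp i a b (goL p pr ∷ goR gl g ∷ rest) with splayUp i (node gl g a) (node b p pr) rest
... | t , m = t , 2 + m
splayUp i a b (goR pl p ∷ goL g gr ∷ rest) with splayUp i (node pl p a) (node b g gr) rest
... | t , m = t , 2 + m

splay : ℕ → Tree → Tree × ℕ
splay i t with locate i t []
... | nothing = t , 0
... | just (a , b , p) = splayUp i a b p

-- Write μ S for the least R-depth of a key of a subtree S, so that φ_R = -2Φ with
-- Φ T = Σ μ S over the subtrees S of T.  The key set of a subtree is an interval of
-- R's keys, and in an interval the key of least R-depth is unique: two keys of equal
-- depth are separated by their lowest common ancestor, which is shallower.  This is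
-- what makes the access-lemma argument go through with rank -2μ.  A zig-zig or
-- zig-zag step bringing i from the root of X to the root of G′ has amortised cost at
-- most 6 (μ X - μ G′); its two rotations are paid for because, if μ X = μ G′, the
-- unique minimiser of G′ lies in X, so it misses one of the two subtrees newly formed
-- below i and the μ of that subtree exceeds μ G′.  A final zig has amortised cost at
-- most 1 + 2 μ X.  Telescoping along the path bounds the amortised cost of the splay
-- by 6 μ X₀ + 1 ≤ 6 d_R(i) + 1 ≤ 7 (1 + d_R(i)).

module Submission where

open import Defs
open import Function using (_∘_; id)
open import Data.Bool using (true; false; T; if_then_else_)
open import Data.Empty using (⊥-elim)
open import Data.Sum using (_⊎_; inj₁; inj₂; map₂)
open import Data.Product using (Σ; _×_; _,_; proj₁; proj₂; ∃)
open import Data.Maybe using (just; nothing)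
open import Data.Nat using (ℕ; suc; _+_; _*_; _≤_; _<_; _<ᵇ_; _≡ᵇ_; s≤s; s<s; z<s)
open import Data.Nat.Properties
open import Data.Nat.Tactic.RingSolver using (solve-∀)
open import Algebra.Properties.CommutativeSemigroup +-commutativeSemigroup using (xy∙z≈xz∙y; x∙yz≈xz∙y)
import Data.Integer as ℤ
import Data.Integer.Properties as ℤ
open import Data.Integer.Tactic.RingSolver renaming (solve-∀ to ℤ-solve-∀)
open import Data.List using (List; []; _∷_; _++_; map)
open import Data.List.Properties using (++-assoc; map-++; map-cong-local)
open import Data.Nat.ListAction using (sum)
open import Data.Nat.ListAction.Properties using (sum-++)
open import Data.List.Relation.Unary.Any using (here; there)
open import Data.List.Relation.Unary.All as All using (All; []; _∷_)
open import Data.List.Relation.Unary.All.Properties using (++⁻)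
open import Data.List.Relation.Unary.AllPairs using (AllPairs; []; _∷_)
open import Data.List.Relation.Unary.AllPairs.Properties as AllPairs using (applyUpTo⁺₁)
open import Data.List.Membership.Propositional using (_∈_; _∉_)
open import Data.List.Membership.Propositional.Properties using (∈-++⁺ˡ; ∈-++⁺ʳ; ∈-++⁻; ∈-map⁺; ∈-map⁻)
open import Data.List.Membership.DecPropositional _≟_ using (_∈?_)
open import Data.List.Relation.Binary.Subset.Propositional using (_⊆_)
open import Relation.Binary.PropositionalEquality
open import Relation.Binary.Definitions using (tri<; tri≈; tri>)
open import Relation.Nullary using (Dec; yes; no)

branch-< : ∀ {A : Set} {j k} (x y z : A) → j < k →
           (if j <ᵇ k then x else if j ≡ᵇ k then y else z) ≡ x
branch-< {j = j} {k} x y z j<k with j <ᵇ k | <⇒<ᵇ j<k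
... | true | _ = refl

branch-≡ : ∀ {A : Set} k (x y z : A) → (if k <ᵇ k then x else if k ≡ᵇ k then y else z) ≡ y
branch-≡ k x y z with k <ᵇ k in lt | k ≡ᵇ k | ≡⇒≡ᵇ k k refl
... | true  | _    | _ = ⊥-elim (n≮n k (<ᵇ⇒< k k (subst T (sym lt) _)))
... | false | true | _ = refl

branch-> : ∀ {A : Set} {j k} (x y z : A) → k < j →
           (if j <ᵇ k then x else if j ≡ᵇ k then y else z) ≡ z
branch-> {j = j} {k} x y z k<j with j <ᵇ k in lt | j ≡ᵇ k in eq
... | true  | _     = ⊥-elim (<⇒≯ k<j (<ᵇ⇒< j k (subst T (sym lt) _)))
... | false | true  = ⊥-elim (>⇒≢ k<j (≡ᵇ⇒≡ j k (subst T (sym eq) _)))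
... | false | false = refl

depth-< : ∀ {k j} l r → j < k → depth (node l k r) j ≡ suc (depth l j)
depth-< l r = branch-< _ _ _

depth-root : ∀ l k r → depth (node l k r) k ≡ 0
depth-root l k r = branch-≡ k _ _ _

depth-> : ∀ {k j} l r → k < j → depth (node l k r) j ≡ suc (depth r j)
depth-> l r = branch-> _ _ _

subtreeAt-< : ∀ {k j} l r → j < k → subtreeAt (node l k r) j ≡ subtreeAt l j
subtreeAt-< l r = branch-< _ _ _

subtreeAt-root : ∀ l k r → subtreeAt (node l k r) k ≡ node l k r
subtreeAt-root l k r = branch-≡ k _ _ _

subtreeAt-> : ∀ {k j} l r → k < j → subtreeAt (node l k r) j ≡ subtreeAt r j
subtreeAt-> l r = branch-> _ _ _

⊆-left : ∀ l k r → inorder l ⊆ inorder (node l k r)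
⊆-left l k r = ∈-++⁺ˡ

∈-root : ∀ l k r → k ∈ inorder (node l k r)
∈-root l k r = ∈-++⁺ʳ (inorder l) (here refl)

⊆-right : ∀ l k r → inorder r ⊆ inorder (node l k r)
⊆-right l k r j∈ = ∈-++⁺ʳ (inorder l) (there j∈)

Sorted : List ℕ → Set
Sorted = AllPairs _<_

AllPairs-++⁻ : ∀ {A : Set} {R : A → A → Set} xs {ys} → AllPairs R (xs ++ ys) →
               AllPairs R xs × AllPairs R ys × All (λ x → All (R x) ys) xs
AllPairs-++⁻ []       rys       = [] , rys , []
AllPairs-++⁻ (x ∷ xs) (rx ∷ rs) with AllPairs-++⁻ xs rs
... | rxs , rys , rxsys with ++⁻ xs rx
...   | rx-xs , rx-ys = rx-xs ∷ rxs , rys , rx-ys ∷ rxsys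

sorted-++-< : ∀ xs {ys x y} → Sorted (xs ++ ys) → x ∈ xs → y ∈ ys → x < y
sorted-++-< xs s x∈ y∈ = All.lookup (All.lookup (proj₂ (proj₂ (AllPairs-++⁻ xs s))) x∈) y∈

sorted-disjoint : ∀ xs {ys x} → Sorted (xs ++ ys) → x ∈ xs → x ∉ ys
sorted-disjoint xs s x∈ x∈′ = n≮n _ (sorted-++-< xs s x∈ x∈′)

data BST : Tree → Set where
  leaf : BST leaf
  node : ∀ {l k r} → BST l → BST r → All (_< k) (inorder l) → All (k <_) (inorder r) → BST (node l k r)

sorted⇒BST : ∀ t → Sorted (inorder t) → BST t
sorted⇒BST leaf _ = leaf
sorted⇒BST (node l k r) s with AllPairs-++⁻ (inorder l) s
... | sl , k<r ∷ sr , l<kr =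
  node (sorted⇒BST l sl) (sorted⇒BST r sr) (All.map (λ x<kr → All.lookup x<kr (here refl)) l<kr) k<r

keys-sorted : ∀ n → Sorted keys[ n ]
keys-sorted n = AllPairs.map⁺ (applyUpTo⁺₁ id n (λ i<j _ → s<s i<j))

data Side (l : Tree) (k : ℕ) (r : Tree) (j : ℕ) : Set where
  left  : j ∈ inorder l → j < k → Side l k r j
  root  : j ≡ k → Side l k r j
  right : j ∈ inorder r → k < j → Side l k r j

side : ∀ {l k r j} → BST (node l k r) → j ∈ inorder (node l k r) → Side l k r j
side {l} (node _ _ l<k k<r) j∈ with ∈-++⁻ (inorder l) j∈
... | inj₁ j∈l         = left j∈l (All.lookup l<k j∈l)
... | inj₂ (here j≡k)  = root j≡k
... | inj₂ (there j∈r) = right j∈r (All.lookup k<r j∈r)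

-- The witness is the lowest common ancestor of u and v.
shallower-between : ∀ {t u v} → BST t → u ∈ inorder t → v ∈ inorder t → u < v → depth t u ≡ depth t v →
                    ∃ λ j → j ∈ inorder t × u < j × j < v × depth t j < depth t v
shallower-between {node l k r} bst@(node bl br _ _) u∈ v∈ u<v du≡dv with side bst u∈ | side bst v∈
... | left u∈l u<k | left v∈l v<k
  with shallower-between bl u∈l v∈l u<v (suc-injective (trans (sym (depth-< l r u<k)) (trans du≡dv (depth-< l r v<k))))
...   | j , j∈ , u<j , j<v , dj<dv =
  j , ⊆-left l k r j∈ , u<j , j<v , subst₂ _<_ (sym (depth-< l r (<-trans j<v v<k))) (sym (depth-< l r v<k)) (s<s dj<dv)
shallower-between {node l k r} (node _ _ _ _) _ _ u<v du≡dv | left _ u<k | root refl =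
  ⊥-elim (1+n≢0 (trans (sym (depth-< l r u<k)) (trans du≡dv (depth-root l k r))))
shallower-between {node l k r} (node _ _ _ _) _ _ u<v du≡dv | left _ u<k | right _ k<v =
  _ , ∈-root l k r , u<k , k<v , subst₂ _<_ (sym (depth-root l k r)) (sym (depth-> l r k<v)) z<s
shallower-between {node l k r} (node _ _ _ _) _ _ u<v du≡dv | root refl | left _ v<k = ⊥-elim (<-asym u<v v<k)
shallower-between {node l k r} (node _ _ _ _) _ _ u<v du≡dv | root refl | root refl = ⊥-elim (n≮n _ u<v)
shallower-between {node l k r} (node _ _ _ _) _ _ u<v du≡dv | root refl | right _ k<v =
  ⊥-elim (1+n≢0 (trans (sym (depth-> l r k<v)) (trans (sym du≡dv) (depth-root l k r))))
shallower-between {node l k r} (node _ _ _ _) _ _ u<v du≡dv | right _ k<u | left _ v<k = ⊥-elim (<-asym u<v (<-trans v<k k<u))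
shallower-between {node l k r} (node _ _ _ _) _ _ u<v du≡dv | right _ k<u | root refl = ⊥-elim (<-asym u<v k<u)
shallower-between {node l k r} bst@(node bl br _ _) u∈ v∈ u<v du≡dv | right u∈r k<u | right v∈r k<v
  with shallower-between br u∈r v∈r u<v (suc-injective (trans (sym (depth-> l r k<u)) (trans du≡dv (depth-> l r k<v))))
...   | j , j∈ , u<j , j<v , dj<dv =
  j , ⊆-right l k r j∈ , u<j , j<v , subst₂ _<_ (sym (depth-> l r (<-trans k<u u<j))) (sym (depth-> l r k<v)) (s<s dj<dv)

minList-≤ : ∀ {x} xs → x ∈ xs → minList xs ≤ x
minList-≤ (x ∷ [])     (here refl) = ≤-refl
minList-≤ (x ∷ y ∷ ys) (here refl) = m⊓n≤m x _
minList-≤ (x ∷ y ∷ ys) (there x∈)  = ≤-trans (m⊓n≤n x _) (minList-≤ (y ∷ ys) x∈)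

minList-∈ : ∀ {x} xs → x ∈ xs → minList xs ∈ xs
minList-∈ (x ∷ [])     _ = here refl
minList-∈ (x ∷ y ∷ ys) _ with ⊓-sel x (minList (y ∷ ys)) | minList-∈ (y ∷ ys) (here refl)
... | inj₁ min≡x | _  = here min≡x
... | inj₂ min≡m | m∈ = there (subst (_∈ y ∷ ys) (sym min≡m) m∈)

plug : Tree → Path → Tree
plug t []            = t
plug t (goL k r ∷ p) = plug (node t k r) p
plug t (goR l k ∷ p) = plug (node l k t) p

inorder-plug : ∀ {t t′} p → inorder t ≡ inorder t′ → inorder (plug t p) ≡ inorder (plug t′ p)
inorder-plug []            io = io
inorder-plug (goL k r ∷ p) io = inorder-plug p (cong (_++ k ∷ inorder r) io)
inorder-plug (goR l k ∷ p) io = inorder-plug p (cong (λ xs → inorder l ++ k ∷ xs) io)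

inorder-rotation : ∀ A x B y C → inorder (node (node A x B) y C) ≡ inorder (node A x (node B y C))
inorder-rotation A x B y C = ++-assoc (inorder A) (x ∷ inorder B) (y ∷ inorder C)

-- The superscripts of a splay step name the path from the grandparent g down to i.
inorder-zigzigˡ : ∀ a i b p pr g gr →
  inorder (node (node (node a i b) p pr) g gr) ≡ inorder (node a i (node b p (node pr g gr)))
inorder-zigzigˡ a i b p pr g gr = trans (inorder-rotation (node a i b) p pr g gr) (inorder-rotation a i b p (node pr g gr))

inorder-zigzigʳ : ∀ a i b pl p gl g →
  inorder (node gl g (node pl p (node a i b))) ≡ inorder (node (node (node gl g pl) p a) i b)
inorder-zigzigʳ a i b pl p gl g = sym (inorder-zigzigˡ gl g pl p a i b)

inorder-zigzagʳˡ : ∀ a i b p pr gl g →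
  inorder (node gl g (node (node a i b) p pr)) ≡ inorder (node (node gl g a) i (node b p pr))
inorder-zigzagʳˡ a i b p pr gl g =
  trans (cong (λ xs → inorder gl ++ g ∷ xs) (inorder-rotation a i b p pr))
        (sym (inorder-rotation gl g a i (node b p pr)))

inorder-zigzagˡʳ : ∀ a i b pl p g gr →
  inorder (node (node pl p (node a i b)) g gr) ≡ inorder (node (node pl p a) i (node b g gr))
inorder-zigzagˡʳ a i b pl p g gr =
  trans (cong (_++ g ∷ inorder gr) (sym (inorder-rotation pl p a i b)))
        (inorder-rotation (node pl p a) i b g gr)

inorder-splayUp : ∀ i a b p → inorder (proj₁ (splayUp i a b p)) ≡ inorder (plug (node a i b) p)
inorder-splayUp i a b []                  = refl
inorder-splayUp i a b (goL k r ∷ [])      = sym (inorder-rotation a i b k r)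
inorder-splayUp i a b (goR l k ∷ [])      = inorder-rotation l k a i b
inorder-splayUp i a b (goL p pr ∷ goL g gr ∷ rest)
  with splayUp i a (node b p (node pr g gr)) rest | inorder-splayUp i a (node b p (node pr g gr)) rest
... | _ , _ | io = trans io (inorder-plug rest (sym (inorder-zigzigˡ a i b p pr g gr)))
inorder-splayUp i a b (goR pl p ∷ goR gl g ∷ rest)
  with splayUp i (node (node gl g pl) p a) b rest | inorder-splayUp i (node (node gl g pl) p a) b rest
... | _ , _ | io = trans io (inorder-plug rest (sym (inorder-zigzigʳ a i b pl p gl g)))
inorder-splayUp i a b (goL p pr ∷ goR gl g ∷ rest)
  with splayUp i (node gl g a) (node b p pr) rest | inorder-splayUp i (node gl g a) (node b p pr) rest
... | _ , _ | io = trans io (inorder-plug rest (sym (inorder-zigzagʳˡ a i b p pr gl g)))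
inorder-splayUp i a b (goR pl p ∷ goL g gr ∷ rest)
  with splayUp i (node pl p a) (node b g gr) rest | inorder-splayUp i (node pl p a) (node b g gr) rest
... | _ , _ | io = trans io (inorder-plug rest (sym (inorder-zigzagˡʳ a i b pl p g gr)))

locate-plug : ∀ i t p {a b p′} → locate i t p ≡ just (a , b , p′) → plug (node a i b) p′ ≡ plug t p
locate-plug i (node l k r) p eq with i <ᵇ k | i ≡ᵇ k in i≡ᵇk
... | true  | _     = locate-plug i l (goL k r ∷ p) eq
... | false | false = locate-plug i r (goR l k ∷ p) eq
... | false | true  with refl ← eq | refl ← ≡ᵇ⇒≡ i k (subst T (sym i≡ᵇk) _) = refl

inorder-splay : ∀ i t → inorder (proj₁ (splay i t)) ≡ inorder t
inorder-splay i t with locate i t [] in eq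
... | nothing          = refl
... | just (a , b , p) = trans (inorder-splayUp i a b p) (cong inorder (locate-plug i t [] eq))

nodeSum : (Tree → ℕ) → Tree → ℕ
nodeSum f leaf         = 0
nodeSum f (node l k r) = nodeSum f l + nodeSum f r + f (node l k r)

sum-subtrees : ∀ (f : Tree → ℕ) {t} → BST t → sum (map (f ∘ subtreeAt t) (inorder t)) ≡ nodeSum f t
sum-subtrees f leaf = refl
sum-subtrees f {node l k r} (node bl br l<k k<r) = begin
  sum (map F (inorder l ++ k ∷ inorder r))                  ≡⟨ cong sum (map-++ F (inorder l) (k ∷ inorder r)) ⟩
  sum (map F (inorder l) ++ F k ∷ map F (inorder r))        ≡⟨ sum-++ (map F (inorder l)) _ ⟩
  sum (map F (inorder l)) + (F k + sum (map F (inorder r))) ≡⟨ cong₂ _+_ on-left (cong₂ _+_ at-root on-right) ⟩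
  nodeSum f l + (f (node l k r) + nodeSum f r)              ≡⟨ x∙yz≈xz∙y (nodeSum f l) _ (nodeSum f r) ⟩
  nodeSum f l + nodeSum f r + f (node l k r)                ∎
  where
  open ≡-Reasoning
  F : ℕ → ℕ
  F = f ∘ subtreeAt (node l k r)
  at-root : F k ≡ f (node l k r)
  at-root = cong f (subtreeAt-root l k r)
  on-left : sum (map F (inorder l)) ≡ nodeSum f l
  on-left = trans (cong sum (map-cong-local (All.map (cong f ∘ subtreeAt-< l r) l<k))) (sum-subtrees f bl)
  on-right : sum (map F (inorder r)) ≡ nodeSum f r
  on-right = trans (cong sum (map-cong-local (All.map (cong f ∘ subtreeAt-> l r) k<r))) (sum-subtrees f br)

one-strict-< : ∀ {x u v z} → z ≤ u → z ≤ v → z ≤ x → z < u ⊎ z < v ⊎ z < x → z + z + z < u + v + x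
one-strict-< z≤u z≤v z≤x (inj₁ z<u)        = +-mono-<-≤ (+-mono-<-≤ z<u z≤v) z≤x
one-strict-< z≤u z≤v z≤x (inj₂ (inj₁ z<v)) = +-mono-<-≤ (+-mono-≤-< z≤u z<v) z≤x
one-strict-< z≤u z≤v z≤x (inj₂ (inj₂ z<x)) = +-mono-≤-< (+-mono-≤ z≤u z≤v) z<x

double-rotation-depth-arith : ∀ {x y z u v} → y ≤ x → z ≤ y → z ≤ u → z ≤ v → (x ≤ z → z < u ⊎ z < v) →
                              2 + 2 * y + 6 * z ≤ 2 * u + 2 * v + 4 * x
double-rotation-depth-arith {x} {y} {z} {u} {v} y≤x z≤y z≤u z≤v rises = begin
  2 + 2 * y + 6 * z           ≤⟨ +-monoˡ-≤ (6 * z) (+-monoʳ-≤ 2 (*-monoʳ-≤ 2 y≤x)) ⟩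
  2 + 2 * x + 6 * z           ≡⟨ regroup₁ x z ⟩
  2 * suc (z + z + z) + 2 * x ≤⟨ +-monoˡ-≤ (2 * x) (*-monoʳ-≤ 2 (one-strict-< z≤u z≤v z≤x one-strict)) ⟩
  2 * (u + v + x) + 2 * x     ≡⟨ regroup₂ u v x ⟩
  2 * u + 2 * v + 4 * x       ∎
  where
  open ≤-Reasoning
  z≤x : z ≤ x
  z≤x = ≤-trans z≤y y≤x
  one-strict : z < u ⊎ z < v ⊎ z < x
  one-strict with x ≤? z
  ... | yes x≤z = map₂ inj₁ (rises x≤z)
  ... | no  x≰z = inj₂ (inj₂ (≰⇒> x≰z))
  regroup₁ : ∀ x z → 2 + 2 * x + 6 * z ≡ 2 * suc (z + z + z) + 2 * x
  regroup₁ = solve-∀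
  regroup₂ : ∀ u v x → 2 * (u + v + x) + 2 * x ≡ 2 * u + 2 * v + 4 * x
  regroup₂ = solve-∀

double-rotation-arith : ∀ g g′ u v x y w → g + u + v ≡ g′ + x + y →
  2 + 2 * y + 6 * w ≤ 2 * u + 2 * v + 4 * x → 2 + 2 * g + 6 * w ≤ 2 * g′ + 6 * x
double-rotation-arith g g′ u v x y w potential depths = +-cancelʳ-≤ (2 * (u + v)) _ _ (begin
  2 + 2 * g + 6 * w + 2 * (u + v)           ≡⟨ regroup₁ g u v w ⟩
  2 + 2 * (g + u + v) + 6 * w               ≡⟨ cong (λ s → 2 + 2 * s + 6 * w) potential ⟩
  2 + 2 * (g′ + x + y) + 6 * w              ≡⟨ regroup₂ g′ x y w ⟩
  2 + 2 * y + 6 * w + (2 * g′ + 2 * x)      ≤⟨ +-monoˡ-≤ (2 * g′ + 2 * x) depths ⟩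
  2 * u + 2 * v + 4 * x + (2 * g′ + 2 * x)  ≡⟨ regroup₃ g′ u v x ⟩
  2 * g′ + 6 * x + 2 * (u + v)              ∎)
  where
  open ≤-Reasoning
  regroup₁ : ∀ g u v w → 2 + 2 * g + 6 * w + 2 * (u + v) ≡ 2 + 2 * (g + u + v) + 6 * w
  regroup₁ = solve-∀
  regroup₂ : ∀ g′ x y w → 2 + 2 * (g′ + x + y) + 6 * w ≡ 2 + 2 * y + 6 * w + (2 * g′ + 2 * x)
  regroup₂ = solve-∀
  regroup₃ : ∀ g′ u v x → 2 * u + 2 * v + 4 * x + (2 * g′ + 2 * x) ≡ 2 * g′ + 6 * x + 2 * (u + v)
  regroup₃ = solve-∀

zig-arith : ∀ g g′ x → g ≤ g′ + x → 1 + 2 * g ≤ 2 * g′ + 6 * x + 1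
zig-arith g g′ x g≤ = begin
  1 + 2 * g                     ≤⟨ +-monoʳ-≤ 1 (*-monoʳ-≤ 2 g≤) ⟩
  1 + 2 * (g′ + x)              ≤⟨ m≤m+n _ (4 * x) ⟩
  1 + 2 * (g′ + x) + 4 * x      ≡⟨ regroup g′ x ⟩
  2 * g′ + 6 * x + 1            ∎
  where
  open ≤-Reasoning
  regroup : ∀ g′ x → 1 + 2 * (g′ + x) + 4 * x ≡ 2 * g′ + 6 * x + 1
  regroup = solve-∀

telescope-arith : ∀ m P P′ g g′ w x t → P + g′ ≡ P′ + g → 2 + 2 * g + 6 * w ≤ 2 * g′ + 6 * x →
  m + 2 * P′ ≤ 2 * t + 6 * w + 1 → 2 + m + 2 * P ≤ 2 * t + 6 * x + 1
telescope-arith m P P′ g g′ w x t potential step rest = +-cancelʳ-≤ (2 * g′ + 6 * w) _ _ (begin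
  2 + m + 2 * P + (2 * g′ + 6 * w)                 ≡⟨ regroup₁ m P g′ w ⟩
  2 + m + 2 * (P + g′) + 6 * w                     ≡⟨ cong (λ s → 2 + m + 2 * s + 6 * w) potential ⟩
  2 + m + 2 * (P′ + g) + 6 * w                     ≡⟨ regroup₂ m P′ g w ⟩
  (2 + 2 * g + 6 * w) + (m + 2 * P′)               ≤⟨ +-mono-≤ step rest ⟩
  (2 * g′ + 6 * x) + (2 * t + 6 * w + 1)           ≡⟨ regroup₃ g′ x t w ⟩
  2 * t + 6 * x + 1 + (2 * g′ + 6 * w)             ∎)
  where
  open ≤-Reasoning
  regroup₁ : ∀ m P g′ w → 2 + m + 2 * P + (2 * g′ + 6 * w) ≡ 2 + m + 2 * (P + g′) + 6 * w
  regroup₁ = solve-∀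
  regroup₂ : ∀ m P′ g w → 2 + m + 2 * (P′ + g) + 6 * w ≡ (2 + 2 * g + 6 * w) + (m + 2 * P′)
  regroup₂ = solve-∀
  regroup₃ : ∀ g′ x t w → (2 * g′ + 6 * x) + (2 * t + 6 * w + 1) ≡ 2 * t + 6 * x + 1 + (2 * g′ + 6 * w)
  regroup₃ = solve-∀

module MinDepth (R : Tree) where

  minDepth : List ℕ → ℕ
  minDepth L = minList (map (depth R) L)

  minDepth-≤ : ∀ {L j} → j ∈ L → minDepth L ≤ depth R j
  minDepth-≤ {L} j∈ = minList-≤ (map (depth R) L) (∈-map⁺ (depth R) j∈)

  -- minList [] = 0, so a lower bound on minDepth L needs a witness that L is nonempty.
  minDepth-attained : ∀ {L j} → j ∈ L → ∃ λ ℓ → ℓ ∈ L × depth R ℓ ≡ minDepth L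
  minDepth-attained {L} j∈ with ∈-map⁻ (depth R) (minList-∈ (map (depth R) L) (∈-map⁺ (depth R) j∈))
  ... | ℓ , ℓ∈ , min≡dℓ = ℓ , ℓ∈ , sym min≡dℓ

  minDepth-greatest : ∀ {L j m} → j ∈ L → (∀ {q} → q ∈ L → m ≤ depth R q) → m ≤ minDepth L
  minDepth-greatest j∈ m≤ with minDepth-attained j∈
  ... | ℓ , ℓ∈ , dℓ≡min = subst (_ ≤_) dℓ≡min (m≤ ℓ∈)

  minDepth-mono : ∀ {A B j} → j ∈ A → A ⊆ B → minDepth B ≤ minDepth A
  minDepth-mono j∈ A⊆B = minDepth-greatest j∈ (λ q∈ → minDepth-≤ (A⊆B q∈))

  -- The key list of a subtree of a search tree whose keys are those of R.
  record Segment (L : List ℕ) : Set where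
    field
      sorted : Sorted L
      keys   : L ⊆ inorder R
      convex : ∀ {u j v} → u ∈ L → v ∈ L → u < j → j < v → j ∈ inorder R → j ∈ L

  open Segment

  segment-++ˡ : ∀ xs {ys} → Segment (xs ++ ys) → Segment xs
  segment-++ˡ xs seg = record
    { sorted = proj₁ (AllPairs-++⁻ xs (sorted seg))
    ; keys   = λ j∈ → keys seg (∈-++⁺ˡ j∈)
    ; convex = convex-xs
    }
    where
    convex-xs : ∀ {u j v} → u ∈ xs → v ∈ xs → u < j → j < v → j ∈ inorder R → j ∈ xs
    convex-xs u∈ v∈ u<j j<v j∈R with ∈-++⁻ xs (convex seg (∈-++⁺ˡ u∈) (∈-++⁺ˡ v∈) u<j j<v j∈R)
    ... | inj₁ j∈xs = j∈xs
    ... | inj₂ j∈ys = ⊥-elim (<-asym j<v (sorted-++-< xs (sorted seg) v∈ j∈ys))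

  segment-++ʳ : ∀ xs {ys} → Segment (xs ++ ys) → Segment ys
  segment-++ʳ xs {ys} seg = record
    { sorted = proj₁ (proj₂ (AllPairs-++⁻ xs (sorted seg)))
    ; keys   = λ j∈ → keys seg (∈-++⁺ʳ xs j∈)
    ; convex = convex-ys
    }
    where
    convex-ys : ∀ {u j v} → u ∈ ys → v ∈ ys → u < j → j < v → j ∈ inorder R → j ∈ ys
    convex-ys u∈ v∈ u<j j<v j∈R with ∈-++⁻ xs (convex seg (∈-++⁺ʳ xs u∈) (∈-++⁺ʳ xs v∈) u<j j<v j∈R)
    ... | inj₁ j∈xs = ⊥-elim (<-asym u<j (sorted-++-< xs (sorted seg) j∈xs u∈))
    ... | inj₂ j∈ys = j∈ys

  segment-whole : Sorted (inorder R) → Segment (inorder R)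
  segment-whole R-sorted = record { sorted = R-sorted ; keys = id ; convex = λ _ _ _ _ j∈R → j∈R }

  segment-plug : ∀ t p → Segment (inorder (plug t p)) → Segment (inorder t)
  segment-plug t []            seg = seg
  segment-plug t (goL k r ∷ p) seg = segment-++ˡ (inorder t) (segment-plug (node t k r) p seg)
  segment-plug t (goR l k ∷ p) seg =
    segment-++ʳ (k ∷ []) (segment-++ʳ (inorder l) (segment-plug (node l k t) p seg))

  segment-replace : ∀ {t t′} p → inorder t ≡ inorder t′ →
                    Segment (inorder (plug t p)) → Segment (inorder (plug t′ p))
  segment-replace p io = subst Segment (inorder-plug p io)

  μ : Tree → ℕ
  μ t = minDepth (inorder t)

  Φ : Tree → ℕ
  Φ = nodeSum μ

  rotation-potential : ∀ A x B y C →
    Φ (node (node A x B) y C) + μ (node B y C) ≡ Φ (node A x (node B y C)) + μ (node A x B)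
  rotation-potential A x B y C =
    trans (cong (λ m → Φ A + Φ B + μ (node A x B) + Φ C + m + μ (node B y C))
                (cong minDepth (inorder-rotation A x B y C)))
          (regroup (Φ A) (Φ B) (Φ C) (μ (node A x B)) (μ (node B y C)) (μ (node A x (node B y C))))
    where
    regroup : ∀ a b c p q m → a + b + p + c + m + q ≡ a + (b + c + q) + m + p
    regroup = solve-∀

  Φ-plug : ∀ {t t′ a b} p → inorder t ≡ inorder t′ →
           Φ t + a ≡ Φ t′ + b → Φ (plug t p) + a ≡ Φ (plug t′ p) + b
  Φ-plug []            _  Φ≡ = Φ≡
  Φ-plug {t} {t′} {a} {b} (goL k r ∷ p) io Φ≡ = Φ-plug p io′ (begin
    Φ t + Φ r + μ (node t k r) + a    ≡⟨ swap (Φ t) (Φ r) _ a ⟩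
    Φ t + a + Φ r + μ (node t k r)    ≡⟨ cong₂ (λ s m → s + Φ r + m) Φ≡ (cong minDepth io′) ⟩
    Φ t′ + b + Φ r + μ (node t′ k r)  ≡⟨ swap (Φ t′) (Φ r) _ b ⟨
    Φ t′ + Φ r + μ (node t′ k r) + b  ∎)
    where
    open ≡-Reasoning
    io′ : inorder (node t k r) ≡ inorder (node t′ k r)
    io′ = cong (_++ k ∷ inorder r) io
    swap : ∀ t r m a → t + r + m + a ≡ t + a + r + m
    swap = solve-∀
  Φ-plug {t} {t′} {a} {b} (goR l k ∷ p) io Φ≡ = Φ-plug p io′ (begin
    Φ l + Φ t + μ (node l k t) + a     ≡⟨ swap (Φ l) (Φ t) _ a ⟩
    Φ l + (Φ t + a) + μ (node l k t)   ≡⟨ cong₂ (λ s m → Φ l + s + m) Φ≡ (cong minDepth io′) ⟩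
    Φ l + (Φ t′ + b) + μ (node l k t′) ≡⟨ swap (Φ l) (Φ t′) _ b ⟨
    Φ l + Φ t′ + μ (node l k t′) + b   ∎)
    where
    open ≡-Reasoning
    io′ : inorder (node l k t) ≡ inorder (node l k t′)
    io′ = cong (λ xs → inorder l ++ k ∷ xs) io
    swap : ∀ l t m a → l + t + m + a ≡ l + (t + a) + m
    swap = solve-∀

  double-rotation-telescopes : ∀ {tg ti′} ti rest t m → inorder tg ≡ inorder ti′ →
    2 + 2 * Φ tg + 6 * μ ti′ ≤ 2 * Φ ti′ + 6 * μ ti →
    m + 2 * Φ (plug ti′ rest) ≤ 2 * Φ t + 6 * μ ti′ + 1 →
    2 + m + 2 * Φ (plug tg rest) ≤ 2 * Φ t + 6 * μ ti + 1
  double-rotation-telescopes {tg} {ti′} ti rest t m io step rest-bound =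
    telescope-arith m (Φ (plug tg rest)) (Φ (plug ti′ rest)) (Φ tg) (Φ ti′) (μ ti′) (μ ti) (Φ t)
      (Φ-plug rest io (+-comm (Φ tg) (Φ ti′))) step rest-bound

  module _ (R-bst : BST R) where

    equal-depths-not-minimal : ∀ {L u v} → Segment L → u ∈ L → v ∈ L → u < v →
                               depth R u ≡ depth R v → depth R v ≢ minDepth L
    equal-depths-not-minimal seg u∈ v∈ u<v du≡dv dv≡min
      with shallower-between R-bst (keys seg u∈) (keys seg v∈) u<v du≡dv
    ... | j , j∈R , u<j , j<v , dj<dv =
      <⇒≱ (subst (_ <_) dv≡min dj<dv) (minDepth-≤ (convex seg u∈ v∈ u<j j<v j∈R))

    minimiser-unique : ∀ {L ℓ q} → Segment L → ℓ ∈ L → q ∈ L →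
                       depth R ℓ ≡ minDepth L → depth R q ≡ minDepth L → ℓ ≡ q
    minimiser-unique {ℓ = ℓ} {q} seg ℓ∈ q∈ dℓ≡min dq≡min with <-cmp ℓ q
    ... | tri< ℓ<q _ _ = ⊥-elim (equal-depths-not-minimal seg ℓ∈ q∈ ℓ<q (trans dℓ≡min (sym dq≡min)) dq≡min)
    ... | tri≈ _ ℓ≡q _ = ℓ≡q
    ... | tri> _ _ q<ℓ = ⊥-elim (equal-depths-not-minimal seg q∈ ℓ∈ q<ℓ (trans dq≡min (sym dℓ≡min)) dℓ≡min)

    minDepth-rises : ∀ {L U ℓ u} → Segment L → ℓ ∈ L → depth R ℓ ≡ minDepth L →
                     u ∈ U → U ⊆ L → ℓ ∉ U → minDepth L < minDepth U
    minDepth-rises seg ℓ∈ dℓ≡min u∈ U⊆L ℓ∉U = minDepth-greatest u∈ λ q∈ →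
      ≤∧≢⇒< (minDepth-≤ (U⊆L q∈))
            (λ min≡dq → ℓ∉U (subst (_∈ _) (sym (minimiser-unique seg ℓ∈ (U⊆L q∈) dℓ≡min (sym min≡dq))) q∈))

    -- If minDepth X = minDepth G, the unique minimiser of G lies in X, hence outside U
    -- or outside V, and the minimum depth of that list exceeds minDepth G.
    double-rotation-depths : ∀ {G X Y U V x u v} → Segment G → x ∈ X → u ∈ U → v ∈ V →
      X ⊆ Y → Y ⊆ G → U ⊆ G → V ⊆ G → (∀ {ℓ} → ℓ ∈ X → ℓ ∈ U → ℓ ∉ V) →
      2 + 2 * minDepth Y + 6 * minDepth G ≤ 2 * minDepth U + 2 * minDepth V + 4 * minDepth X
    double-rotation-depths {G} {X} {Y} {U} {V} seg x∈ u∈ v∈ X⊆Y Y⊆G U⊆G V⊆G X∩U∩V≡∅ =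
      double-rotation-depth-arith (minDepth-mono x∈ X⊆Y) (minDepth-mono (X⊆Y x∈) Y⊆G)
                                  (minDepth-mono u∈ U⊆G) (minDepth-mono v∈ V⊆G) rises
      where
      rises : minDepth X ≤ minDepth G → minDepth G < minDepth U ⊎ minDepth G < minDepth V
      rises x≤g with minDepth-attained x∈
      ... | ℓ , ℓ∈X , dℓ≡x = by-membership (ℓ ∈? U)
        where
        ℓ∈G : ℓ ∈ G
        ℓ∈G = Y⊆G (X⊆Y ℓ∈X)
        dℓ≡g : depth R ℓ ≡ minDepth G
        dℓ≡g = ≤-antisym (subst (_≤ minDepth G) (sym dℓ≡x) x≤g) (minDepth-≤ ℓ∈G)
        by-membership : Dec (ℓ ∈ U) → minDepth G < minDepth U ⊎ minDepth G < minDepth V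
        by-membership (yes ℓ∈U) = inj₂ (minDepth-rises seg ℓ∈G dℓ≡g v∈ V⊆G (X∩U∩V≡∅ ℓ∈X ℓ∈U))
        by-membership (no ℓ∉U)  = inj₁ (minDepth-rises seg ℓ∈G dℓ≡g u∈ U⊆G ℓ∉U)

    -- ti, tp, tg are the subtrees rooted at i, its parent p and its grandparent g before
    -- the step, ti′, tp′, tg′ those rooted at the same keys after it.
    zigzigˡ-amortised : ∀ a i b p pr g gr → Segment (inorder (node (node (node a i b) p pr) g gr)) →
      2 + 2 * Φ (node (node (node a i b) p pr) g gr) + 6 * μ (node a i (node b p (node pr g gr)))
        ≤ 2 * Φ (node a i (node b p (node pr g gr))) + 6 * μ (node a i b)
    zigzigˡ-amortised a i b p pr g gr seg =
      double-rotation-arith (Φ tg) (Φ ti′) (μ tg′) (μ tp′) (μ ti) (μ tp) (μ ti′)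
        potential
        (double-rotation-depths seg′ (∈-root a i b) (∈-root pr g gr) (∈-root b p tg′)
           (⊆-left ti p pr) tp⊆ (⊆-right a i tp′ ∘ ⊆-right b p tg′) (⊆-right a i tp′) disjoint)
      where
      ti tp tg tg′ tp′ ti′ : Tree
      ti  = node a i b
      tp  = node ti p pr
      tg  = node tp g gr
      ti′ = node a i tp′
      tg′ = node pr g gr
      tp′ = node b p tg′
      io : inorder tg ≡ inorder ti′
      io = inorder-zigzigˡ a i b p pr g gr
      potential : Φ tg + μ tg′ + μ tp′ ≡ Φ ti′ + μ ti + μ tp
      potential = begin
        Φ tg + μ tg′ + μ tp′            ≡⟨ cong (_+ μ tp′) (rotation-potential ti p pr g gr) ⟩
        Φ (node ti p tg′) + μ tp + μ tp′ ≡⟨ xy∙z≈xz∙y (Φ (node ti p tg′)) (μ tp) (μ tp′) ⟩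
        Φ (node ti p tg′) + μ tp′ + μ tp ≡⟨ cong (_+ μ tp) (rotation-potential a i b p tg′) ⟩
        Φ ti′ + μ ti + μ tp              ∎
        where open ≡-Reasoning
      seg′ : Segment (inorder (node a i tp′))
      seg′ = subst Segment io seg
      tp⊆ : inorder tp ⊆ inorder (node a i tp′)
      tp⊆ = subst (inorder tp ⊆_) io (⊆-left tp g gr)
      disjoint : ∀ {ℓ} → ℓ ∈ inorder ti → ℓ ∈ inorder tg′ → ℓ ∉ inorder tp′
      disjoint ℓ∈ti ℓ∈tg′ _ = sorted-disjoint (inorder ti)
        (subst Sorted (sym (inorder-rotation a i b p tg′)) (sorted seg′)) ℓ∈ti (there ℓ∈tg′)

    zigzigʳ-amortised : ∀ a i b pl p gl g → Segment (inorder (node gl g (node pl p (node a i b)))) →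
      2 + 2 * Φ (node gl g (node pl p (node a i b))) + 6 * μ (node (node (node gl g pl) p a) i b)
        ≤ 2 * Φ (node (node (node gl g pl) p a) i b) + 6 * μ (node a i b)
    zigzigʳ-amortised a i b pl p gl g seg =
      double-rotation-arith (Φ tg) (Φ ti′) (μ tg′) (μ tp′) (μ ti) (μ tp) (μ ti′)
        potential
        (double-rotation-depths seg′ (∈-root a i b) (∈-root gl g pl) (∈-root tg′ p a)
           (⊆-right pl p ti) tp⊆ (⊆-left tp′ i b ∘ ⊆-left tg′ p a) (⊆-left tp′ i b) disjoint)
      where
      ti tp tg tg′ tp′ ti′ : Tree
      ti  = node a i b
      tp  = node pl p ti
      tg  = node gl g tp
      tg′ = node gl g pl
      tp′ = node tg′ p a
      ti′ = node tp′ i b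
      io : inorder tg ≡ inorder ti′
      io = inorder-zigzigʳ a i b pl p gl g
      potential : Φ tg + μ tg′ + μ tp′ ≡ Φ ti′ + μ ti + μ tp
      potential = begin
        Φ tg + μ tg′ + μ tp′             ≡⟨ cong (_+ μ tp′) (rotation-potential gl g pl p ti) ⟨
        Φ (node tg′ p ti) + μ tp + μ tp′ ≡⟨ xy∙z≈xz∙y (Φ (node tg′ p ti)) (μ tp) (μ tp′) ⟩
        Φ (node tg′ p ti) + μ tp′ + μ tp ≡⟨ cong (_+ μ tp) (rotation-potential tg′ p a i b) ⟨
        Φ ti′ + μ ti + μ tp              ∎
        where open ≡-Reasoning
      seg′ : Segment (inorder ti′)
      seg′ = subst Segment io seg
      tp⊆ : inorder tp ⊆ inorder ti′
      tp⊆ = subst (inorder tp ⊆_) io (⊆-right gl g tp)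
      disjoint : ∀ {ℓ} → ℓ ∈ inorder ti → ℓ ∈ inorder tg′ → ℓ ∉ inorder tp′
      disjoint ℓ∈ti ℓ∈tg′ _ = sorted-disjoint (inorder tg′)
        (subst Sorted (inorder-rotation tg′ p a i b) (sorted seg′)) ℓ∈tg′ (there ℓ∈ti)

    zigzagʳˡ-amortised : ∀ a i b p pr gl g → Segment (inorder (node gl g (node (node a i b) p pr))) →
      2 + 2 * Φ (node gl g (node (node a i b) p pr)) + 6 * μ (node (node gl g a) i (node b p pr))
        ≤ 2 * Φ (node (node gl g a) i (node b p pr)) + 6 * μ (node a i b)
    zigzagʳˡ-amortised a i b p pr gl g seg =
      double-rotation-arith (Φ tg) (Φ ti′) (μ tg′) (μ tp′) (μ ti) (μ tp) (μ ti′)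
        potential
        (double-rotation-depths seg′ (∈-root a i b) (∈-root gl g a) (∈-root b p pr)
           (⊆-left ti p pr) tp⊆ (⊆-left tg′ i tp′) (⊆-right tg′ i tp′) disjoint)
      where
      ti tp tg tg′ tp′ ti′ t₁ : Tree
      ti  = node a i b
      tp  = node ti p pr
      tg  = node gl g tp
      tg′ = node gl g a
      tp′ = node b p pr
      ti′ = node tg′ i tp′
      t₁  = node gl g (node a i tp′)
      inner-inorder : inorder tp ≡ inorder (node a i tp′)
      inner-inorder = inorder-rotation a i b p pr
      inner-rotation : Φ tg + μ tp′ ≡ Φ t₁ + μ ti
      inner-rotation = Φ-plug {tp} {node a i tp′} {μ tp′} {μ ti} (goR gl g ∷ []) inner-inorder
                              (rotation-potential a i b p pr)
      io : inorder tg ≡ inorder ti′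
      io = inorder-zigzagʳˡ a i b p pr gl g
      potential : Φ tg + μ tg′ + μ tp′ ≡ Φ ti′ + μ ti + μ tp
      potential = begin
        Φ tg + μ tg′ + μ tp′            ≡⟨ xy∙z≈xz∙y (Φ tg) (μ tg′) (μ tp′) ⟩
        Φ tg + μ tp′ + μ tg′            ≡⟨ cong (_+ μ tg′) inner-rotation ⟩
        Φ t₁ + μ ti + μ tg′             ≡⟨ xy∙z≈xz∙y (Φ t₁) (μ ti) (μ tg′) ⟩
        Φ t₁ + μ tg′ + μ ti             ≡⟨ cong (_+ μ ti) (rotation-potential gl g a i tp′) ⟨
        Φ ti′ + μ (node a i tp′) + μ ti ≡⟨ cong (λ m → Φ ti′ + m + μ ti) (cong minDepth inner-inorder) ⟨
        Φ ti′ + μ tp + μ ti             ≡⟨ xy∙z≈xz∙y (Φ ti′) (μ tp) (μ ti) ⟩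
        Φ ti′ + μ ti + μ tp             ∎
        where open ≡-Reasoning
      seg′ : Segment (inorder ti′)
      seg′ = subst Segment io seg
      tp⊆ : inorder tp ⊆ inorder ti′
      tp⊆ = subst (inorder tp ⊆_) io (⊆-right gl g tp)
      disjoint : ∀ {ℓ} → ℓ ∈ inorder ti → ℓ ∈ inorder tg′ → ℓ ∉ inorder tp′
      disjoint _ ℓ∈tg′ ℓ∈tp′ = sorted-disjoint (inorder tg′) (sorted seg′) ℓ∈tg′ (there ℓ∈tp′)

    zigzagˡʳ-amortised : ∀ a i b pl p g gr → Segment (inorder (node (node pl p (node a i b)) g gr)) →
      2 + 2 * Φ (node (node pl p (node a i b)) g gr) + 6 * μ (node (node pl p a) i (node b g gr))
        ≤ 2 * Φ (node (node pl p a) i (node b g gr)) + 6 * μ (node a i b)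
    zigzagˡʳ-amortised a i b pl p g gr seg =
      double-rotation-arith (Φ tg) (Φ ti′) (μ tp′) (μ tg′) (μ ti) (μ tp) (μ ti′)
        potential
        (double-rotation-depths seg′ (∈-root a i b) (∈-root pl p a) (∈-root b g gr)
           (⊆-right pl p ti) tp⊆ (⊆-left tp′ i tg′) (⊆-right tp′ i tg′) disjoint)
      where
      ti tp tg tp′ tg′ ti′ t₁ : Tree
      ti  = node a i b
      tp  = node pl p ti
      tg  = node tp g gr
      tp′ = node pl p a
      tg′ = node b g gr
      ti′ = node tp′ i tg′
      t₁  = node (node tp′ i b) g gr
      inner-inorder : inorder tp ≡ inorder (node tp′ i b)
      inner-inorder = sym (inorder-rotation pl p a i b)
      inner-rotation : Φ tg + μ tp′ ≡ Φ t₁ + μ ti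
      inner-rotation = Φ-plug {tp} {node tp′ i b} {μ tp′} {μ ti} (goL g gr ∷ []) inner-inorder
                              (sym (rotation-potential pl p a i b))
      io : inorder tg ≡ inorder ti′
      io = inorder-zigzagˡʳ a i b pl p g gr
      potential : Φ tg + μ tp′ + μ tg′ ≡ Φ ti′ + μ ti + μ tp
      potential = begin
        Φ tg + μ tp′ + μ tg′             ≡⟨ cong (_+ μ tg′) inner-rotation ⟩
        Φ t₁ + μ ti + μ tg′              ≡⟨ xy∙z≈xz∙y (Φ t₁) (μ ti) (μ tg′) ⟩
        Φ t₁ + μ tg′ + μ ti              ≡⟨ cong (_+ μ ti) (rotation-potential tp′ i b g gr) ⟩
        Φ ti′ + μ (node tp′ i b) + μ ti  ≡⟨ cong (λ m → Φ ti′ + m + μ ti) (cong minDepth inner-inorder) ⟨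
        Φ ti′ + μ tp + μ ti              ≡⟨ xy∙z≈xz∙y (Φ ti′) (μ tp) (μ ti) ⟩
        Φ ti′ + μ ti + μ tp              ∎
        where open ≡-Reasoning
      seg′ : Segment (inorder ti′)
      seg′ = subst Segment io seg
      tp⊆ : inorder tp ⊆ inorder ti′
      tp⊆ = subst (inorder tp ⊆_) io (⊆-left tp g gr)
      disjoint : ∀ {ℓ} → ℓ ∈ inorder ti → ℓ ∈ inorder tp′ → ℓ ∉ inorder tg′
      disjoint _ ℓ∈tp′ ℓ∈tg′ = sorted-disjoint (inorder tp′) (sorted seg′) ℓ∈tp′ (there ℓ∈tg′)

    splayUp-amortised : ∀ i a b p → Segment (inorder (plug (node a i b) p)) →
      proj₂ (splayUp i a b p) + 2 * Φ (plug (node a i b) p)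
        ≤ 2 * Φ (proj₁ (splayUp i a b p)) + 6 * μ (node a i b) + 1
    splayUp-amortised i a b [] _ = ≤-trans (m≤m+n (2 * Φ (node a i b)) (6 * μ (node a i b))) (m≤m+n _ 1)
    splayUp-amortised i a b (goL k r ∷ []) _ =
      zig-arith (Φ (node (node a i b) k r)) (Φ (node a i (node b k r))) (μ (node a i b))
        (≤-trans (m≤m+n _ (μ (node b k r))) (≤-reflexive (rotation-potential a i b k r)))
    splayUp-amortised i a b (goR l k ∷ []) _ =
      zig-arith (Φ (node l k (node a i b))) (Φ (node (node l k a) i b)) (μ (node a i b))
        (≤-trans (m≤m+n _ (μ (node l k a))) (≤-reflexive (sym (rotation-potential l k a i b))))
    splayUp-amortised i a b (goL p pr ∷ goL g gr ∷ rest) seg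
      with splayUp i a (node b p (node pr g gr)) rest
         | splayUp-amortised i a (node b p (node pr g gr)) rest
             (segment-replace rest (inorder-zigzigˡ a i b p pr g gr) seg)
    ... | t , m | ih = double-rotation-telescopes (node a i b) rest t m (inorder-zigzigˡ a i b p pr g gr)
                         (zigzigˡ-amortised a i b p pr g gr (segment-plug _ rest seg)) ih
    splayUp-amortised i a b (goR pl p ∷ goR gl g ∷ rest) seg
      with splayUp i (node (node gl g pl) p a) b rest
         | splayUp-amortised i (node (node gl g pl) p a) b rest
             (segment-replace rest (inorder-zigzigʳ a i b pl p gl g) seg)
    ... | t , m | ih = double-rotation-telescopes (node a i b) rest t m (inorder-zigzigʳ a i b pl p gl g)
                         (zigzigʳ-amortised a i b pl p gl g (segment-plug _ rest seg)) ih
    splayUp-amortised i a b (goL p pr ∷ goR gl g ∷ rest) seg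
      with splayUp i (node gl g a) (node b p pr) rest
         | splayUp-amortised i (node gl g a) (node b p pr) rest
             (segment-replace rest (inorder-zigzagʳˡ a i b p pr gl g) seg)
    ... | t , m | ih = double-rotation-telescopes (node a i b) rest t m (inorder-zigzagʳˡ a i b p pr gl g)
                         (zigzagʳˡ-amortised a i b p pr gl g (segment-plug _ rest seg)) ih
    splayUp-amortised i a b (goR pl p ∷ goL g gr ∷ rest) seg
      with splayUp i (node pl p a) (node b g gr) rest
         | splayUp-amortised i (node pl p a) (node b g gr) rest
             (segment-replace rest (inorder-zigzagˡʳ a i b pl p g gr) seg)
    ... | t , m | ih = double-rotation-telescopes (node a i b) rest t m (inorder-zigzagˡʳ a i b pl p g gr)
                         (zigzagˡʳ-amortised a i b pl p g gr (segment-plug _ rest seg)) ih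

open MinDepth using (μ; Φ; minDepth-≤; Segment; segment-whole; splayUp-amortised)

φ≡-2Φ : ∀ {n} R T → IsBSTOn n T → φ n R T ≡ ℤ.- (ℤ.+ (2 * Φ R T))
φ≡-2Φ {n} R T T-on = cong (λ s → ℤ.- (ℤ.+ (2 * s))) (begin
  sum (map (minDepthIn R T) keys[ n ])   ≡⟨ cong (sum ∘ map (minDepthIn R T)) T-on ⟨
  sum (map (minDepthIn R T) (inorder T)) ≡⟨ sum-subtrees (μ R) (sorted⇒BST T (subst Sorted (sym T-on) (keys-sorted n))) ⟩
  Φ R T                                  ∎)
  where open ≡-Reasoning

splay-amortised : ∀ n R T i → IsBSTOn n R → IsBSTOn n T →
  proj₂ (splay i T) + 2 * Φ R T ≤ 2 * Φ R (proj₁ (splay i T)) + 7 * suc (depth R i)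
splay-amortised n R T i R-on T-on with locate i T [] in eq
... | nothing = m≤m+n (2 * Φ R T) _
... | just (a , b , p) rewrite sym (locate-plug i T [] eq) = begin
  m + 2 * Φ R (plug (node a i b) p)         ≤⟨ splayUp-amortised R R-bst i a b p seg ⟩
  2 * Φ R T′ + 6 * μ R (node a i b) + 1     ≡⟨ +-assoc (2 * Φ R T′) _ 1 ⟩
  2 * Φ R T′ + (6 * μ R (node a i b) + 1)   ≤⟨ +-monoʳ-≤ (2 * Φ R T′) (6x+1≤7[1+x] (μ R (node a i b))) ⟩
  2 * Φ R T′ + 7 * suc (μ R (node a i b))   ≤⟨ +-monoʳ-≤ (2 * Φ R T′) (*-monoʳ-≤ 7 (s≤s μ≤depth)) ⟩
  2 * Φ R T′ + 7 * suc (depth R i)          ∎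
  where
  open ≤-Reasoning
  T′ : Tree
  T′ = proj₁ (splayUp i a b p)
  m : ℕ
  m = proj₂ (splayUp i a b p)
  μ≤depth : μ R (node a i b) ≤ depth R i
  μ≤depth = minDepth-≤ R (∈-root a i b)
  R-sorted : Sorted (inorder R)
  R-sorted = subst Sorted (sym R-on) (keys-sorted n)
  R-bst : BST R
  R-bst = sorted⇒BST R R-sorted
  seg : Segment R (inorder (plug (node a i b) p))
  seg = subst (Segment R) (trans R-on (sym T-on)) (segment-whole R R-sorted)
  6x+1≤7[1+x] : ∀ x → 6 * x + 1 ≤ 7 * suc x
  6x+1≤7[1+x] x = subst (6 * x + 1 ≤_) (regroup x) (m≤m+n (6 * x + 1) (6 + x))
    where
    regroup : ∀ x → 6 * x + 1 + (6 + x) ≡ 7 * suc x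
    regroup = solve-∀

ℕ-bound⇒ℤ : ∀ m A A′ K → m + A ≤ A′ + K → ℤ.+ m ℤ.+ (ℤ.- (ℤ.+ A′) ℤ.- ℤ.- (ℤ.+ A)) ℤ.≤ ℤ.+ K
ℕ-bound⇒ℤ m A A′ K m+A≤ = begin
  ℤ.+ m ℤ.+ (ℤ.- (ℤ.+ A′) ℤ.- ℤ.- (ℤ.+ A)) ≡⟨ regroup₁ (ℤ.+ m) (ℤ.+ A) (ℤ.+ A′) ⟩
  ℤ.+ m ℤ.+ ℤ.+ A ℤ.- ℤ.+ A′              ≡⟨ cong (ℤ._- ℤ.+ A′) (ℤ.pos-+ m A) ⟨
  ℤ.+ (m + A) ℤ.- ℤ.+ A′                  ≤⟨ ℤ.+-monoˡ-≤ (ℤ.- ℤ.+ A′) (ℤ.+≤+ m+A≤) ⟩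
  ℤ.+ (A′ + K) ℤ.- ℤ.+ A′                 ≡⟨ cong (ℤ._- ℤ.+ A′) (ℤ.pos-+ A′ K) ⟩
  ℤ.+ A′ ℤ.+ ℤ.+ K ℤ.- ℤ.+ A′             ≡⟨ regroup₂ (ℤ.+ A′) (ℤ.+ K) ⟩
  ℤ.+ K                                   ∎
  where
  open ℤ.≤-Reasoning
  regroup₁ : ∀ x y z → x ℤ.+ (ℤ.- z ℤ.- ℤ.- y) ≡ x ℤ.+ y ℤ.- z
  regroup₁ = ℤ-solve-∀
  regroup₂ : ∀ y z → y ℤ.+ z ℤ.- y ≡ z
  regroup₂ = ℤ-solve-∀

-- Splaying a key absent from T leaves T unchanged.
mainTheorem7 : Σ ℕ (λ c → (n : ℕ) (R T : Tree) (i : ℕ) → IsBSTOn n R → IsBSTOn n T → 1 ≤ i → i ≤ n →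
    (ℤ.+ proj₂ (splay i T)) ℤ.+ (φ n R (proj₁ (splay i T)) ℤ.- φ n R T) ℤ.≤ ℤ.+ (c * suc (depth R i)))
mainTheorem7 = 7 , λ n R T i R-on T-on _ _ →
  subst₂ (λ φ′ φ₀ → ℤ.+ proj₂ (splay i T) ℤ.+ (φ′ ℤ.- φ₀) ℤ.≤ ℤ.+ (7 * suc (depth R i)))
    (sym (φ≡-2Φ R (proj₁ (splay i T)) (trans (inorder-splay i T) T-on))) (sym (φ≡-2Φ R T T-on))
    (ℕ-bound⇒ℤ _ _ _ _ (splay-amortised n R T i R-on T-on))
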